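{- Let $G$ be a $(2,1)$-graph. Then the $(2,2)$-circuits in $G$ are pairwise edge-disjoint.
   Context: For a subgraph, $n'$ is the number of vertices it spans, $m'$ its number of edges. A graph with $n$ vertices and $m$ edges is $(k,\ell)$-sparse if every non-empty subgraph has $m'\le kn'-\ell$, and is a $(k,\ell)$-graph if moreover $m=kn-\ell$. A $(k,\ell)$-circuit is an edge-minimal graph that is not $(k,\ell)$-sparse. -}

module Defs where

open import Data.Nat using (ℕ; zero; suc; _+_; _*_; _≤_)
open import Data.Bool using (Bool; true; false; _∨_; _∧_)
open import Data.Fin using (Fin; zero; suc; _≟_)
open import Data.Fin.Subset using (Subset; _∈_; _⊆_; _-_; ∣_∣; Nonempty; Empty; _∩_)
open import Data.Product using (_×_; proj₁; proj₂)
open import Data.Vec using (Vec; lookup; tabulate)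
open import Relation.Nullary using (¬_)
open import Relation.Nullary.Decidable using (⌊_⌋)

-- A finite multigraph (parallel edges and loops allowed) on vertex set Fin n
-- with edge set Fin m; edge e has endpoints  ends e.
record Graph : Set where
  field
    n    : ℕ
    m    : ℕ
    ends : Fin m → Fin n × Fin n
open Graph public

anyFin : {k : ℕ} → (Fin k → Bool) → Bool
anyFin {zero}  f = false
anyFin {suc k} f = f zero ∨ anyFin (λ i → f (suc i))

incident : (G : Graph) → Fin (m G) → Fin (n G) → Bool
incident G e v = ⌊ proj₁ (ends G e) ≟ v ⌋ ∨ ⌊ proj₂ (ends G e) ≟ v ⌋

span : (G : Graph) → Subset (m G) → Subset (n G)
span G S = tabulate λ v → anyFin λ e → lookup S e ∧ incident G e v

nv : (G : Graph) → Subset (m G) → ℕ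
nv G S = ∣ span G S ∣

-- The subgraph formed by the edge set C (with the vertices it spans) is
-- (k,ℓ)-sparse: every non-empty subgraph of it has m' ≤ k n' - ℓ
-- (written m' + ℓ ≤ k n' to avoid truncated subtraction).
SparseOn : ℕ → ℕ → (G : Graph) → Subset (m G) → Set
SparseOn k ℓ G C = ∀ (S : Subset (m G)) → S ⊆ C → Nonempty S → ∣ S ∣ + ℓ ≤ k * nv G S

Sparse : ℕ → ℕ → Graph → Set
Sparse k ℓ G = ∀ (S : Subset (m G)) → Nonempty S → ∣ S ∣ + ℓ ≤ k * nv G S

IsKLGraph : ℕ → ℕ → Graph → Set
IsKLGraph k ℓ G = Sparse k ℓ G × (m G + ℓ ≡ k * n G)
  where open import Relation.Binary.PropositionalEquality using (_≡_)

IsCircuitIn : ℕ → ℕ → (G : Graph) → Subset (m G) → Set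
IsCircuitIn k ℓ G C = ¬ SparseOn k ℓ G C × (∀ e → e ∈ C → SparseOn k ℓ G (C - e))

EdgeDisjoint : {k : ℕ} → Subset k → Subset k → Set
EdgeDisjoint A B = Empty (A ∩ B)

module Submission where

-- Let G be (k,ℓ)-sparse and let C₁ ≠ C₂ be two (k,ℓ+1)-circuits
-- sharing an edge.  Write I = C₁ ∩ C₂ and U = C₁ ∪ C₂, and n'(S) for the
-- number of vertices spanned by an edge set S.
--   * A circuit violates its own count:  k n'(C) < |C| + ℓ + 1.
--   * A non-empty part S ⊆ C that violates the count already contains C
--     (minimality), so I, a non-empty proper part of both circuits,
--     satisfies  |I| + ℓ + 1 ≤ k n'(I).
--   * Sparsity of G gives  |U| + ℓ ≤ k n'(U).
--   * Edges count modularly, |U| + |I| = |C₁| + |C₂|, and spanned vertices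
--     submodularly, n'(U) + n'(I) ≤ n'(C₁) + n'(C₂).
-- Adding up the four inequalities gives  2ℓ + 1 ≤ 2ℓ, a contradiction.

open import Defs
open import Data.Fin.Subset using (Subset)
open import Relation.Binary.PropositionalEquality using (_≡_)
open import Relation.Nullary using (¬_)

open import Data.Nat using (ℕ; suc; _+_; _*_; _≤_; _<_; _≤?_; _<?_; s≤s⁻¹)
open import Data.Nat.Properties
  using (+-suc; +-mono-≤; *-monoʳ-≤; *-distribˡ-+; ≮⇒≥; <-irrefl; n<1+n; module ≤-Reasoning)
open import Data.Nat.Tactic.RingSolver using (solve-∀)
open import Data.Bool using (Bool; true; false; _∧_)
open import Data.Bool.Properties using (∨-zeroʳ)
open import Data.Fin using (Fin; zero; suc)
open import Data.Fin.Subset using (_∈_; _⊆_; _-_; ∣_∣; Nonempty; _∩_; _∪_)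
open import Data.Fin.Subset.Properties
  using ( _∈?_; ⊆-antisym; p∩q⊆p; p∩q⊆q; p⊆p∪q; x∈p∩q⁺; x∈p∪q⁺; x∈p∪q⁻
        ; x∈p∧x∉q⇒x∈p─q; x≢y⇒x∉⁅y⁆; p⊆q⇒∣p∣≤∣q∣ )
open import Data.Product using (∃; _×_; _,_; proj₁)
open import Data.Sum using (inj₁; inj₂)
open import Data.Empty using (⊥)
open import Data.Vec using (_∷_; []; lookup)
open import Data.Vec.Properties using ([]=⇒lookup; lookup⇒[]=; lookup∘tabulate)
open import Relation.Nullary using (yes; no; contradiction)
open import Relation.Nullary.Decidable using (decidable-stable)
open import Relation.Binary.PropositionalEquality using (refl; sym; trans; cong; subst)

anyFin⇒∃ : {k : ℕ} (f : Fin k → Bool) → anyFin f ≡ true → ∃ λ i → f i ≡ true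
anyFin⇒∃ {suc k} f eq with f zero in f0
... | true  = zero , f0
... | false with anyFin⇒∃ (λ i → f (suc i)) eq
...   | i , fi = suc i , fi

∃⇒anyFin : {k : ℕ} (f : Fin k → Bool) (i : Fin k) → f i ≡ true → anyFin f ≡ true
∃⇒anyFin f zero    fi rewrite fi = refl
∃⇒anyFin f (suc i) fi rewrite ∃⇒anyFin (λ j → f (suc j)) i fi = ∨-zeroʳ (f zero)

∧-true⁻ : ∀ a b → a ∧ b ≡ true → a ≡ true × b ≡ true
∧-true⁻ true true refl = refl , refl

span⁻ : (G : Graph) (S : Subset (m G)) (v : Fin (n G)) → v ∈ span G S →
        ∃ λ e → e ∈ S × incident G e v ≡ true
span⁻ G S v v∈ with anyFin⇒∃ _ (trans (sym (lookup∘tabulate _ v)) ([]=⇒lookup v∈))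
... | e , hit with ∧-true⁻ _ _ hit
...   | e∈S , inc = e , lookup⇒[]= e S e∈S , inc

span⁺ : (G : Graph) (S : Subset (m G)) (v : Fin (n G)) (e : Fin (m G)) →
        e ∈ S → incident G e v ≡ true → v ∈ span G S
span⁺ G S v e e∈S inc =
  lookup⇒[]= v (span G S) (trans (lookup∘tabulate _ v) (∃⇒anyFin _ e hit))
  where
  hit : lookup S e ∧ incident G e v ≡ true
  hit rewrite []=⇒lookup e∈S = inc

span-mono : (G : Graph) {S T : Subset (m G)} → S ⊆ T → span G S ⊆ span G T
span-mono G {S} {T} S⊆T {v} v∈ with span⁻ G S v v∈
... | e , e∈S , inc = span⁺ G T v e (S⊆T e∈S) inc

span-∪ : (G : Graph) (A B : Subset (m G)) → span G (A ∪ B) ⊆ span G A ∪ span G B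
span-∪ G A B {v} v∈ with span⁻ G (A ∪ B) v v∈
... | e , e∈A∪B , inc with x∈p∪q⁻ A B e∈A∪B
...   | inj₁ e∈A = x∈p∪q⁺ (inj₁ (span⁺ G A v e e∈A inc))
...   | inj₂ e∈B = x∈p∪q⁺ (inj₂ (span⁺ G B v e e∈B inc))

span-∩ : (G : Graph) (A B : Subset (m G)) → span G (A ∩ B) ⊆ span G A ∩ span G B
span-∩ G A B v∈ = x∈p∩q⁺ (span-mono G (p∩q⊆p A B) v∈ , span-mono G (p∩q⊆q A B) v∈)

∣∪∣+∣∩∣ : {k : ℕ} (p q : Subset k) → ∣ p ∪ q ∣ + ∣ p ∩ q ∣ ≡ ∣ p ∣ + ∣ q ∣
∣∪∣+∣∩∣ []          []          = refl
∣∪∣+∣∩∣ (true ∷ p)  (true ∷ q)  =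
  cong suc (trans (+-suc _ _) (trans (cong suc (∣∪∣+∣∩∣ p q)) (sym (+-suc _ _))))
∣∪∣+∣∩∣ (true ∷ p)  (false ∷ q) = cong suc (∣∪∣+∣∩∣ p q)
∣∪∣+∣∩∣ (false ∷ p) (true ∷ q)  = trans (cong suc (∣∪∣+∣∩∣ p q)) (sym (+-suc _ _))
∣∪∣+∣∩∣ (false ∷ p) (false ∷ q) = ∣∪∣+∣∩∣ p q

nv-submodular : (G : Graph) (A B : Subset (m G)) →
                nv G (A ∪ B) + nv G (A ∩ B) ≤ nv G A + nv G B
nv-submodular G A B = begin
  nv G (A ∪ B) + nv G (A ∩ B)
    ≤⟨ +-mono-≤ (p⊆q⇒∣p∣≤∣q∣ (span-∪ G A B)) (p⊆q⇒∣p∣≤∣q∣ (span-∩ G A B)) ⟩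
  ∣ span G A ∪ span G B ∣ + ∣ span G A ∩ span G B ∣
    ≡⟨ ∣∪∣+∣∩∣ (span G A) (span G B) ⟩
  nv G A + nv G B ∎
  where open ≤-Reasoning

Counts : ℕ → ℕ → (G : Graph) → Subset (m G) → Set
Counts k ℓ G S = ∣ S ∣ + ℓ ≤ k * nv G S

violator-contains-circuit : ∀ k ℓ (G : Graph) {C S : Subset (m G)} → IsCircuitIn k ℓ G C →
  S ⊆ C → Nonempty S → ¬ Counts k ℓ G S → C ⊆ S
violator-contains-circuit k ℓ G {C} {S} (_ , minimal) S⊆C ne violates {e} e∈C
  with e ∈? S
... | yes e∈S = e∈S
... | no  e∉S = contradiction (minimal e e∈C S S⊆C-e ne) violates
  where
  S⊆C-e : S ⊆ C - e
  S⊆C-e {f} f∈S = x∈p∧x∉q⇒x∈p─q (S⊆C f∈S) (x≢y⇒x∉⁅y⁆ λ f≡e → e∉S (subst (_∈ S) f≡e f∈S))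

circuit-deficient : ∀ k ℓ (G : Graph) {C : Subset (m G)} → IsCircuitIn k ℓ G C →
                    k * nv G C < ∣ C ∣ + ℓ
circuit-deficient k ℓ G {C} circuit =
  decidable-stable (_ <? _) λ ¬deficient → proj₁ circuit (sparse (≮⇒≥ ¬deficient))
  where
  sparse : ∣ C ∣ + ℓ ≤ k * nv G C → SparseOn k ℓ G C
  sparse C-counts S S⊆C ne = decidable-stable (_ ≤? _) λ violates →
    violates (subst (Counts k ℓ G)
      (⊆-antisym (violator-contains-circuit k ℓ G circuit S⊆C ne violates) S⊆C) C-counts)

overlap-counts : ∀ k ℓ (G : Graph) {C₁ C₂ : Subset (m G)} →
  IsCircuitIn k ℓ G C₁ → IsCircuitIn k ℓ G C₂ → ¬ (C₁ ≡ C₂) →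
  Nonempty (C₁ ∩ C₂) → Counts k ℓ G (C₁ ∩ C₂)
overlap-counts k ℓ G {C₁} {C₂} circuit₁ circuit₂ C₁≢C₂ ne =
  decidable-stable (_ ≤? _) λ violates → C₁≢C₂ (⊆-antisym
    (λ e∈C₁ → p∩q⊆q C₁ C₂
      (violator-contains-circuit k ℓ G circuit₁ (p∩q⊆p C₁ C₂) ne violates e∈C₁))
    (λ e∈C₂ → p∩q⊆p C₁ C₂
      (violator-contains-circuit k ℓ G circuit₂ (p∩q⊆q C₁ C₂) ne violates e∈C₂)))

overlap-impossible : ∀ k ℓ u i c₁ c₂ nU nI n₁ n₂ →
  u + ℓ ≤ k * nU → i + suc ℓ ≤ k * nI →
  k * n₁ < c₁ + suc ℓ → k * n₂ < c₂ + suc ℓ →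
  u + i ≡ c₁ + c₂ → nU + nI ≤ n₁ + n₂ → ⊥
overlap-impossible k ℓ u i c₁ c₂ nU nI n₁ n₂ U-counts I-counts def₁ def₂ edges vertices =
  <-irrefl refl (begin-strict
    (u + ℓ) + (i + suc ℓ)  ≤⟨ +-mono-≤ U-counts I-counts ⟩
    k * nU + k * nI        ≡⟨ sym (*-distribˡ-+ k nU nI) ⟩
    k * (nU + nI)          ≤⟨ *-monoʳ-≤ k vertices ⟩
    k * (n₁ + n₂)          ≡⟨ *-distribˡ-+ k n₁ n₂ ⟩
    k * n₁ + k * n₂        ≤⟨ +-mono-≤ (tighten def₁) (tighten def₂) ⟩
    (c₁ + ℓ) + (c₂ + ℓ)    ≡⟨ regroup c₁ c₂ ℓ ⟩
    (c₁ + c₂) + (ℓ + ℓ)    ≡⟨ cong (_+ (ℓ + ℓ)) (sym edges) ⟩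
    (u + i) + (ℓ + ℓ)      <⟨ n<1+n _ ⟩
    suc ((u + i) + (ℓ + ℓ)) ≡⟨ spread u i ℓ ⟩
    (u + ℓ) + (i + suc ℓ)  ∎)
  where
  open ≤-Reasoning
  tighten : ∀ {a c} → a < c + suc ℓ → a ≤ c + ℓ
  tighten {a} {c} a<c+1+ℓ = s≤s⁻¹ (subst (a <_) (+-suc c ℓ) a<c+1+ℓ)
  regroup : ∀ a b l → (a + l) + (b + l) ≡ (a + b) + (l + l)
  regroup = solve-∀
  spread : ∀ a b l → suc ((a + b) + (l + l)) ≡ (a + l) + (b + suc l)
  spread = solve-∀

circuits-edge-disjoint : ∀ k ℓ (G : Graph) → Sparse k ℓ G →
  (C₁ C₂ : Subset (m G)) → IsCircuitIn k (suc ℓ) G C₁ → IsCircuitIn k (suc ℓ) G C₂ →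
  ¬ (C₁ ≡ C₂) → EdgeDisjoint C₁ C₂
circuits-edge-disjoint k ℓ G sparse C₁ C₂ circuit₁ circuit₂ C₁≢C₂ ne@(e , e∈I) =
  overlap-impossible k ℓ
    (∣ C₁ ∪ C₂ ∣) (∣ C₁ ∩ C₂ ∣) (∣ C₁ ∣) (∣ C₂ ∣)
    (nv G (C₁ ∪ C₂)) (nv G (C₁ ∩ C₂)) (nv G C₁) (nv G C₂)
    (sparse (C₁ ∪ C₂) (e , p⊆p∪q C₂ (p∩q⊆p C₁ C₂ e∈I)))
    (overlap-counts k (suc ℓ) G circuit₁ circuit₂ C₁≢C₂ ne)
    (circuit-deficient k (suc ℓ) G circuit₁)
    (circuit-deficient k (suc ℓ) G circuit₂)
    (∣∪∣+∣∩∣ C₁ C₂)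
    (nv-submodular G C₁ C₂)

mainTheorem9 : (G : Graph) → IsKLGraph 2 1 G →
    (C₁ C₂ : Subset (m G)) → IsCircuitIn 2 2 G C₁ → IsCircuitIn 2 2 G C₂ →
    ¬ (C₁ ≡ C₂) → EdgeDisjoint C₁ C₂
mainTheorem9 G (sparse , _) = circuits-edge-disjoint 2 1 G sparse
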